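{- For each nonnegative integer $m$, $d_m(2m)=D_m$; that is, the number of alternating permutations of $[2m]$ having exactly $m$ fixed points equals the number of derangements of $[m]$. -}

module Defs where

open import Data.Bool using (Bool; true; false; _∧_; not)
open import Data.Nat using (ℕ; zero; suc; _<ᵇ_; _≡ᵇ_)
open import Data.Fin using (Fin; toℕ)
open import Data.List using (List; []; _∷_; map; concatMap; length; filterᵇ; allFin)
open import Data.Vec using (Vec; []; _∷_; lookup; toList)

allWords : (k n : ℕ) → List (Vec (Fin n) k)
allWords zero    n = [] ∷ []
allWords (suc k) n = concatMap (λ x → map (x ∷_) (allWords k n)) (allFin n)

allᵇ : ∀ {A : Set} → (A → Bool) → List A → Bool
allᵇ p []       = true
allᵇ p (x ∷ xs) = p x ∧ allᵇ p xs

isPerm : ∀ {n} → Vec (Fin n) n → Bool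
isPerm {n} w =
  allᵇ (λ i → allᵇ (λ j → (toℕ i ≡ᵇ toℕ j) ∨' not (toℕ (lookup w i) ≡ᵇ toℕ (lookup w j))) (allFin n)) (allFin n)
  where
  _∨'_ : Bool → Bool → Bool
  true  ∨' _ = true
  false ∨' b = b

-- All permutations of [n], in one-line notation (entries 0..n-1 encode 1..n).
perms : (n : ℕ) → List (Vec (Fin n) n)
perms n = filterᵇ isPerm (allWords n n)

-- Alternating (Stanley's convention): w1 > w2 < w3 > w4 < ...
mutual
  downUp : List ℕ → Bool
  downUp (x ∷ y ∷ r) = (y <ᵇ x) ∧ upDown (y ∷ r)
  downUp _           = true

  upDown : List ℕ → Bool
  upDown (x ∷ y ∷ r) = (x <ᵇ y) ∧ downUp (y ∷ r)
  upDown _           = true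

isAlternating : ∀ {n} → Vec (Fin n) n → Bool
isAlternating w = downUp (map toℕ (toList w))

fixedPoints : ∀ {n} → Vec (Fin n) n → ℕ
fixedPoints {n} w = length (filterᵇ (λ i → toℕ (lookup w i) ≡ᵇ toℕ i) (allFin n))

d : ℕ → ℕ → ℕ
d k n = length (filterᵇ (λ w → isAlternating w ∧ (fixedPoints w ≡ᵇ k)) (perms n))

D : ℕ → ℕ
D m = length (filterᵇ (λ w → fixedPoints w ≡ᵇ 0) (perms m))

module Submission where

-- Split the positions 0, …, 2m−1 into the pairs {2k, 2k+1}.  An alternating permutation w
-- has w (2k+1) < w (2k), so no pair holds two fixed points, and m fixed points means exactly
-- one in every pair.  As w permutes its non-fixed points, it sends the unfixed position of
-- pair k to the unfixed position of a pair σ k ≠ k, and σ is a derangement of {0, …, m−1}.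
-- Conversely, a derangement σ determines w: pair k moves its position 2k if σ k > k and its
-- position 2k+1 if σ k < k, w sends that position to the moving position of pair σ k, and
-- fixes everything else.  Then 2k ≤ w (2k) and w (2k+1) ≤ 2k+1 with exactly one of them
-- strict, which yields both the descents within and the ascents between pairs.

open import Defs
open import Data.Bool using (Bool; true; false; T; if_then_else_; _∧_)
open import Data.Bool.Properties using (T-∧)
open import Data.Empty using (⊥-elim)
open import Data.Fin using (Fin; toℕ; fromℕ<)
import Data.Fin as Fin
open import Data.Fin.Properties using (toℕ-injective; toℕ<n; toℕ-fromℕ<; nonZeroIndex)
open import Data.List using (List; []; _∷_; map; length; filterᵇ; allFin; tabulate)
open import Data.List.Properties using (length-map; map-∘; map-id-local)
open import Data.List.Membership.Propositional using (_∈_)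
open import Data.List.Membership.Propositional.Properties
  using (∈-map⁺; ∈-map⁻; ∈-allFin; ∈-concatMap⁺; ∈-filter⁻; ∈-filter⁺)
open import Data.List.Membership.Propositional.Properties.WithK using (unique∧set⇒bag)
open import Data.List.Relation.Binary.BagAndSetEquality using (∼bag⇒↭)
open import Data.List.Relation.Binary.Disjoint.Propositional using (Disjoint)
open import Data.List.Relation.Binary.Permutation.Propositional.Properties using (↭-length)
open import Data.List.Relation.Unary.Any using (here; there)
import Data.List.Relation.Unary.Any as Any
import Data.List.Relation.Unary.All as All
import Data.List.Relation.Unary.All.Properties as All
import Data.List.Relation.Unary.AllPairs as AllPairs
import Data.List.Relation.Unary.AllPairs.Properties as AllPairs
open import Data.List.Relation.Unary.Unique.Propositional using (Unique)
import Data.List.Relation.Unary.Unique.Propositional.Properties as Unique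
open import Data.Nat using (ℕ; zero; suc; _+_; _*_; _≤_; _<_; z≤n; s≤s; _≟_; _<?_; _≡ᵇ_; _<ᵇ_; ⌊_/2⌋)
open import Data.Nat.DivMod using (_mod_; _%_; m<n⇒m%n≡m)
open import Data.Nat.Properties
  using (+-suc; n≤1+n; <-trans; n<1+n; <-irrefl; ≤-trans; suc-injective; <ᵇ⇒<; <⇒<ᵇ; <⇒≱; ⌊n/2⌋-mono; <-asym; ≤-refl; ≤∧≢⇒<; ≮⇒≥; ≤-<-trans; <-≤-trans; <⇒≤; ≤-reflexive; >⇒≢; 1+n≢n; ≡ᵇ⇒≡; ≡⇒≡ᵇ)
open import Data.Product using (_×_; _,_; proj₁; proj₂; ∃)
open import Data.Sum using (_⊎_; inj₁; inj₂)
import Data.Sum as Sum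
open import Data.Unit using (tt)
open import Data.Vec using (Vec; []; _∷_; lookup; toList)
import Data.Vec as Vec
open import Data.Vec.Properties using (∷-injectiveˡ; ∷-injectiveʳ; length-toList; lookup∘tabulate; tabulate∘lookup; tabulate-cong)
open import Function using (_∘_)
open import Function.Bundles using (Equivalence; _⇔_; mk⇔)
open import Level using (0ℓ)
open import Relation.Nullary using (¬_; yes; no; does; contradiction)
open import Relation.Nullary.Decidable using (T?; dec-true; dec-false)
open import Relation.Unary using (Pred; Decidable)
open import Relation.Binary.PropositionalEquality

-- Counting duplicate-free lists

length-≡-by-inverses : ∀ {A B : Set} {xs : List A} {ys : List B} → Unique xs → Unique ys →
  (f : A → B) (g : B → A) →
  (∀ {x} → x ∈ xs → f x ∈ ys) → (∀ {y} → y ∈ ys → g y ∈ xs) →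
  (∀ {x} → x ∈ xs → g (f x) ≡ x) → (∀ {y} → y ∈ ys → f (g y) ≡ y) →
  length xs ≡ length ys
length-≡-by-inverses {xs = xs} {ys} xs! ys! f g f∈ g∈ gf fg =
  trans (sym (length-map f xs)) (↭-length (∼bag⇒↭ (unique∧set⇒bag fxs! ys! (mk⇔ to from))))
  where
  fxs! : Unique (map f xs)
  fxs! = Unique.map⁻ {f = g} (subst Unique (sym (trans (sym (map-∘ xs)) (map-id-local (All.tabulate gf)))) xs!)
  to : ∀ {y} → y ∈ map f xs → y ∈ ys
  to y∈ with x , x∈ , refl ← ∈-map⁻ f y∈ = f∈ x∈
  from : ∀ {y} → y ∈ ys → y ∈ map f xs
  from y∈ = subst (_∈ map f xs) (fg y∈) (∈-map⁺ f (g∈ y∈))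

∈-allWords : ∀ {k n} (v : Vec (Fin n) k) → v ∈ allWords k n
∈-allWords []      = here refl
∈-allWords {suc k} {n} (x ∷ v) =
  ∈-concatMap⁺ (λ y → map (y ∷_) (allWords k n)) (Any.map (λ { refl → ∈-map⁺ (x ∷_) (∈-allWords v) }) (∈-allFin x))

allWords-unique : ∀ k n → Unique (allWords k n)
allWords-unique zero    n = All.[] AllPairs.∷ AllPairs.[]
allWords-unique (suc k) n = Unique.concat⁺
  (All.map⁺ (All.universal (λ x → Unique.map⁺ ∷-injectiveʳ (allWords-unique k n)) _))
  (AllPairs.map⁺ (AllPairs.map disjoint (Unique.allFin⁺ n)))
  where
  disjoint : ∀ {x y} → x ≢ y → Disjoint (map (x ∷_) (allWords k n)) (map (y ∷_) (allWords k n))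
  disjoint x≢y (v∈x , v∈y) with _ , _ , refl ← ∈-map⁻ _ v∈x | _ , _ , eq ← ∈-map⁻ _ v∈y = x≢y (∷-injectiveˡ eq)

-- Pairs of positions

double : ℕ → ℕ
double zero    = zero
double (suc k) = suc (suc (double k))

double≡2* : ∀ k → double k ≡ 2 * k
double≡2* zero    = refl
double≡2* (suc k) = cong suc (trans (cong suc (double≡2* k)) (sym (+-suc k (k + 0))))

⌊2n/2⌋≡n : ∀ n → ⌊ double n /2⌋ ≡ n
⌊2n/2⌋≡n zero    = refl
⌊2n/2⌋≡n (suc n) = cong suc (⌊2n/2⌋≡n n)

⌊1+2n/2⌋≡n : ∀ n → ⌊ suc (double n) /2⌋ ≡ n
⌊1+2n/2⌋≡n zero    = refl
⌊1+2n/2⌋≡n (suc n) = cong suc (⌊1+2n/2⌋≡n n)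

parity : ∀ i → i ≡ double ⌊ i /2⌋ ⊎ i ≡ suc (double ⌊ i /2⌋)
parity zero    = inj₁ refl
parity (suc zero) = inj₂ refl
parity (suc (suc i)) with parity i
... | inj₁ e = inj₁ (cong (suc ∘ suc) e)
... | inj₂ e = inj₂ (cong (suc ∘ suc) e)

⌊n/2⌋<m : ∀ {n m} → n < double m → ⌊ n /2⌋ < m
⌊n/2⌋<m {zero}        {suc m} _ = s≤s z≤n
⌊n/2⌋<m {suc zero}    {suc m} _ = s≤s z≤n
⌊n/2⌋<m {suc (suc n)} {suc m} (s≤s (s≤s n<2m)) = s≤s (⌊n/2⌋<m n<2m)

double-mono-≤ : ∀ {m n} → m ≤ n → double m ≤ double n
double-mono-≤ z≤n       = z≤n
double-mono-≤ (s≤s m≤n) = s≤s (s≤s (double-mono-≤ m≤n))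

1+2m<2n : ∀ {m n} → m < n → suc (double m) < double n
1+2m<2n (s≤s m≤n) = s≤s (s≤s (double-mono-≤ m≤n))

2m<2n : ∀ {m n} → m < n → double m < double n
2m<2n m<n = <-trans (n<1+n _) (1+2m<2n m<n)

1+2m<2n⇒m<n : ∀ {m n} → suc (double m) < double n → m < n
1+2m<2n⇒m<n {zero}  {suc n} _                  = s≤s z≤n
1+2m<2n⇒m<n {suc m} {suc n} (s≤s (s≤s lt)) = s≤s (1+2m<2n⇒m<n lt)

2m<2n⇒m<n : ∀ {m n} → double m < double n → m < n
2m<2n⇒m<n {zero}  {suc n} _                  = s≤s z≤n
2m<2n⇒m<n {suc m} {suc n} (s≤s (s≤s lt)) = s≤s (2m<2n⇒m<n lt)

countBelow : {P : Pred ℕ 0ℓ} → Decidable P → ℕ → ℕ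
countBelow P? zero    = 0
countBelow P? (suc n) = (if does (P? 0) then 1 else 0) + countBelow (P? ∘ suc) n

countBelow≡0 : ∀ {P : Pred ℕ 0ℓ} (P? : Decidable P) n → (∀ {i} → i < n → ¬ P i) → countBelow P? n ≡ 0
countBelow≡0 P? zero    none = refl
countBelow≡0 P? (suc n) none with P? 0
... | yes p0 = contradiction p0 (none (s≤s z≤n))
... | no _   = countBelow≡0 (P? ∘ suc) n (none ∘ s≤s)

countBelow≡0⁻ : ∀ {P : Pred ℕ 0ℓ} (P? : Decidable P) n → countBelow P? n ≡ 0 → ∀ {i} → i < n → ¬ P i
countBelow≡0⁻ P? (suc n) count≡0 {i} i<n with P? 0
countBelow≡0⁻ P? (suc n) ()      {i}     _         | yes _
countBelow≡0⁻ P? (suc n) count≡0 {zero}  _         | no ¬p0 = ¬p0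
countBelow≡0⁻ P? (suc n) count≡0 {suc i} (s≤s i<n) | no _   = countBelow≡0⁻ (P? ∘ suc) n count≡0 i<n

NeverBothInPair : Pred ℕ 0ℓ → ℕ → Set
NeverBothInPair P m = ∀ {k} → k < m → ¬ (P (double k) × P (suc (double k)))

InEachPair : Pred ℕ 0ℓ → ℕ → Set
InEachPair P m = ∀ {k} → k < m → P (double k) ⊎ P (suc (double k))

countBelow-pairs≤ : ∀ {P : Pred ℕ 0ℓ} (P? : Decidable P) m → NeverBothInPair P m → countBelow P? (double m) ≤ m
countBelow-pairs≤ P? zero    _     = z≤n
countBelow-pairs≤ P? (suc m) never with P? 0 | P? 1
... | yes p0 | yes p1 = contradiction (p0 , p1) (never (s≤s z≤n))
... | yes _  | no _   = s≤s (countBelow-pairs≤ (P? ∘ suc ∘ suc) m (never ∘ s≤s))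
... | no _   | yes _  = s≤s (countBelow-pairs≤ (P? ∘ suc ∘ suc) m (never ∘ s≤s))
... | no _   | no _   = ≤-trans (countBelow-pairs≤ (P? ∘ suc ∘ suc) m (never ∘ s≤s)) (n≤1+n m)

countBelow-pairs≡ : ∀ {P : Pred ℕ 0ℓ} (P? : Decidable P) m →
  NeverBothInPair P m → InEachPair P m → countBelow P? (double m) ≡ m
countBelow-pairs≡ P? zero    _     _    = refl
countBelow-pairs≡ P? (suc m) never each with P? 0 | P? 1 | each (s≤s z≤n)
... | yes p0 | yes p1 | _      = contradiction (p0 , p1) (never (s≤s z≤n))
... | yes _  | no _   | _      = cong suc (countBelow-pairs≡ (P? ∘ suc ∘ suc) m (never ∘ s≤s) (each ∘ s≤s))
... | no _   | yes _  | _      = cong suc (countBelow-pairs≡ (P? ∘ suc ∘ suc) m (never ∘ s≤s) (each ∘ s≤s))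
... | no ¬p0 | no ¬p1 | inj₁ p0 = contradiction p0 ¬p0
... | no ¬p0 | no ¬p1 | inj₂ p1 = contradiction p1 ¬p1

InEachPair-∷ : ∀ {P : Pred ℕ 0ℓ} {m} → P 0 ⊎ P 1 → InEachPair (P ∘ suc ∘ suc) m → InEachPair P (suc m)
InEachPair-∷ first rest {zero}  _         = first
InEachPair-∷ first rest {suc k} (s≤s k<m) = rest k<m

countBelow-pairs≡⁻ : ∀ {P : Pred ℕ 0ℓ} (P? : Decidable P) m →
  NeverBothInPair P m → countBelow P? (double m) ≡ m → InEachPair P m
countBelow-pairs≡⁻     P? zero    _     _      ()
countBelow-pairs≡⁻ {P} P? (suc m) never count≡ with P? 0 | P? 1
... | yes p0 | yes p1 = contradiction (p0 , p1) (never (s≤s z≤n))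
... | yes p0 | no _   = InEachPair-∷ {P} (inj₁ p0) (countBelow-pairs≡⁻ (P? ∘ suc ∘ suc) m (never ∘ s≤s) (suc-injective count≡))
... | no _   | yes p1 = InEachPair-∷ {P} (inj₂ p1) (countBelow-pairs≡⁻ (P? ∘ suc ∘ suc) m (never ∘ s≤s) (suc-injective count≡))
... | no _   | no _   = ⊥-elim (<-irrefl count≡ (s≤s (countBelow-pairs≤ (P? ∘ suc ∘ suc) m (never ∘ s≤s))))

-- Alternation

nth : List ℕ → ℕ → ℕ
nth []       _       = 0
nth (x ∷ xs) zero    = x
nth (x ∷ xs) (suc i) = nth xs i

record Alternating (f : ℕ → ℕ) (n : ℕ) : Set where
  field
    descent : ∀ {k} → suc (double k) < n → f (suc (double k)) < f (double k)
    ascent  : ∀ {k} → double (suc k) < n → f (suc (double k)) < f (double (suc k))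

downUp-tail : ∀ x y z l → T (downUp (x ∷ y ∷ z ∷ l)) → T (downUp (z ∷ l))
downUp-tail x y z l t = proj₂ (to (T-∧ {y <ᵇ z}) (proj₂ (to (T-∧ {y <ᵇ x}) t)))
  where open Equivalence using (to)

downUp⇒descent : ∀ l → T (downUp l) → ∀ {k} → suc (double k) < length l → nth l (suc (double k)) < nth l (double k)
downUp⇒descent (x ∷ [])        t {zero}  (s≤s ())
downUp⇒descent (x ∷ y ∷ l)     t {zero}  _                = <ᵇ⇒< y x (proj₁ (Equivalence.to T-∧ t))
downUp⇒descent (x ∷ y ∷ z ∷ l) t {suc k} (s≤s (s≤s lt)) = downUp⇒descent (z ∷ l) (downUp-tail x y z l t) lt

downUp⇒ascent : ∀ l → T (downUp l) → ∀ {k} → double (suc k) < length l → nth l (suc (double k)) < nth l (double (suc k))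
downUp⇒ascent (x ∷ [])        t {zero}  (s≤s ())
downUp⇒ascent (x ∷ y ∷ [])    t {zero}  (s≤s (s≤s ()))
downUp⇒ascent (x ∷ y ∷ z ∷ l) t {zero}  _                = <ᵇ⇒< y z (proj₁ (to T-∧ (proj₂ (to (T-∧ {y <ᵇ x}) t))))
  where open Equivalence using (to)
downUp⇒ascent (x ∷ y ∷ z ∷ l) t {suc k} (s≤s (s≤s lt)) = downUp⇒ascent (z ∷ l) (downUp-tail x y z l t) lt

downUp⇒alternating : ∀ l → T (downUp l) → Alternating (nth l) (length l)
downUp⇒alternating l t = record { descent = downUp⇒descent l t ; ascent = downUp⇒ascent l t }

alternating⇒downUp : ∀ l → Alternating (nth l) (length l) → T (downUp l)
alternating⇒downUp []              _ = tt
alternating⇒downUp (x ∷ [])         _ = tt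
alternating⇒downUp (x ∷ y ∷ [])     a =
  Equivalence.from T-∧ (<⇒<ᵇ (Alternating.descent a {0} (s≤s (s≤s z≤n))) , tt)
alternating⇒downUp (x ∷ y ∷ z ∷ l) a =
  from T-∧ (<⇒<ᵇ (descent {0} (s≤s (s≤s z≤n))) ,
    from T-∧ (<⇒<ᵇ (ascent {0} (s≤s (s≤s (s≤s z≤n)))) ,
      alternating⇒downUp (z ∷ l) record
        { descent = λ lt → descent (s≤s (s≤s lt)) ; ascent = λ lt → ascent (s≤s (s≤s lt)) }))
  where
  open Equivalence using (from)
  open Alternating a

-- The bijection on functions ℕ → ℕ

record IsPermutation (f : ℕ → ℕ) (n : ℕ) : Set where
  field
    bounded   : ∀ {i} → i < n → f i < n
    injective : ∀ {i j} → i < n → j < n → f i ≡ f j → i ≡ j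

record IsDerangement (σ : ℕ → ℕ) (m : ℕ) : Set where
  field
    permutation      : IsPermutation σ m
    fixed-point-free : ∀ {k} → k < m → σ k ≢ k

record IsPairFixingAlternating (f : ℕ → ℕ) (m : ℕ) : Set where
  field
    permutation : IsPermutation f (double m)
    alternating : Alternating f (double m)
    fixed-in-each-pair : InEachPair (λ i → f i ≡ i) m

IsPermutation-resp : ∀ {f g n} → (∀ {i} → i < n → f i ≡ g i) → IsPermutation f n → IsPermutation g n
IsPermutation-resp f≗g perm = record
  { bounded   = λ i<n → subst (_< _) (f≗g i<n) (bounded i<n)
  ; injective = λ i<n j<n gi≡gj → injective i<n j<n (trans (f≗g i<n) (trans gi≡gj (sym (f≗g j<n))))
  }
  where open IsPermutation perm

IsDerangement-resp : ∀ {σ τ m} → (∀ {k} → k < m → σ k ≡ τ k) → IsDerangement σ m → IsDerangement τ m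
IsDerangement-resp σ≗τ der = record
  { permutation      = IsPermutation-resp σ≗τ permutation
  ; fixed-point-free = λ k<m τk≡k → fixed-point-free k<m (trans (σ≗τ k<m) τk≡k)
  }
  where open IsDerangement der

Alternating-resp : ∀ {f g n} → (∀ {i} → i < n → f i ≡ g i) → Alternating f n → Alternating g n
Alternating-resp f≗g alt = record
  { descent = λ lt → subst₂ _<_ (f≗g lt) (f≗g (<-trans (n<1+n _) lt)) (descent lt)
  ; ascent  = λ lt → subst₂ _<_ (f≗g (<-trans (n<1+n _) lt)) (f≗g lt) (ascent lt)
  }
  where open Alternating alt

IsPairFixingAlternating-resp : ∀ {f g m} → (∀ {i} → i < double m → f i ≡ g i) →
  IsPairFixingAlternating f m → IsPairFixingAlternating g m
IsPairFixingAlternating-resp f≗g H = record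
  { permutation        = IsPermutation-resp f≗g permutation
  ; alternating        = Alternating-resp f≗g alternating
  ; fixed-in-each-pair = λ k<m → Sum.map (trans (sym (f≗g (2m<2n k<m))))
                                               (trans (sym (f≗g (1+2m<2n k<m)))) (fixed-in-each-pair k<m)
  }
  where open IsPairFixingAlternating H

descent⇒never-both-fixed : ∀ {f m} → Alternating f (double m) → NeverBothInPair (λ i → f i ≡ i) m
descent⇒never-both-fixed {f} alt k<m (even-fixed , odd-fixed) =
  <⇒≱ (subst₂ _<_ odd-fixed even-fixed (Alternating.descent alt (1+2m<2n k<m))) (n≤1+n _)

unfixedIn : (ℕ → ℕ) → ℕ → ℕ
unfixedIn f k = if does (f (double k) ≟ double k) then suc (double k) else double k

toDerangement : (ℕ → ℕ) → ℕ → ℕ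
toDerangement f k = ⌊ f (unfixedIn f k) /2⌋

slot : (ℕ → ℕ) → ℕ → ℕ
slot σ j = if does (j <? σ j) then double j else suc (double j)

toAlternating : (ℕ → ℕ) → ℕ → ℕ
toAlternating σ i = if does (i ≟ slot σ ⌊ i /2⌋) then slot σ (σ ⌊ i /2⌋) else i

unfixedIn-fixed : ∀ f {k} → f (double k) ≡ double k → unfixedIn f k ≡ suc (double k)
unfixedIn-fixed f {k} fixed rewrite dec-true (f (double k) ≟ double k) fixed = refl

unfixedIn-unfixed : ∀ f {k} → f (double k) ≢ double k → unfixedIn f k ≡ double k
unfixedIn-unfixed f {k} unfixed rewrite dec-false (f (double k) ≟ double k) unfixed = refl

unfixedIn-< : ∀ f {k m} → k < m → unfixedIn f k < double m
unfixedIn-< f {k} k<m with does (f (double k) ≟ double k)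
... | true  = 1+2m<2n k<m
... | false = 2m<2n k<m

⌊unfixedIn/2⌋ : ∀ f k → ⌊ unfixedIn f k /2⌋ ≡ k
⌊unfixedIn/2⌋ f k with does (f (double k) ≟ double k)
... | true  = ⌊1+2n/2⌋≡n k
... | false = ⌊2n/2⌋≡n k

slot-up : ∀ σ {j} → j < σ j → slot σ j ≡ double j
slot-up σ {j} up rewrite dec-true (j <? σ j) up = refl

slot-down : ∀ σ {j} → ¬ j < σ j → slot σ j ≡ suc (double j)
slot-down σ {j} ¬up rewrite dec-false (j <? σ j) ¬up = refl

slot-≥ : ∀ σ j → double j ≤ slot σ j
slot-≥ σ j with does (j <? σ j)
... | true  = ≤-refl
... | false = n≤1+n _

slot-≤ : ∀ σ j → slot σ j ≤ suc (double j)
slot-≤ σ j with does (j <? σ j)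
... | true  = n≤1+n _
... | false = ≤-refl

⌊slot/2⌋ : ∀ σ j → ⌊ slot σ j /2⌋ ≡ j
⌊slot/2⌋ σ j with does (j <? σ j)
... | true  = ⌊2n/2⌋≡n j
... | false = ⌊1+2n/2⌋≡n j

toAlternating-on-slot : ∀ σ {i} → i ≡ slot σ ⌊ i /2⌋ → toAlternating σ i ≡ slot σ (σ ⌊ i /2⌋)
toAlternating-on-slot σ {i} on rewrite dec-true (i ≟ slot σ ⌊ i /2⌋) on = refl

toAlternating-off-slot : ∀ σ {i} → i ≢ slot σ ⌊ i /2⌋ → toAlternating σ i ≡ i
toAlternating-off-slot σ {i} off rewrite dec-false (i ≟ slot σ ⌊ i /2⌋) off = refl

toAlternating-slot : ∀ σ k → toAlternating σ (slot σ k) ≡ slot σ (σ k)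
toAlternating-slot σ k = begin
  toAlternating σ (slot σ k)          ≡⟨ toAlternating-on-slot σ (cong (slot σ) (sym (⌊slot/2⌋ σ k))) ⟩
  slot σ (σ ⌊ slot σ k /2⌋)           ≡⟨ cong (slot σ ∘ σ) (⌊slot/2⌋ σ k) ⟩
  slot σ (σ k)                        ∎
  where open ≡-Reasoning

toAlternating-even-off : ∀ σ {k} → slot σ k ≡ suc (double k) → toAlternating σ (double k) ≡ double k
toAlternating-even-off σ {k} odd = toAlternating-off-slot σ λ on →
  1+n≢n (sym (trans on (trans (cong (slot σ) (⌊2n/2⌋≡n k)) odd)))

toAlternating-odd-off : ∀ σ {k} → slot σ k ≡ double k → toAlternating σ (suc (double k)) ≡ suc (double k)
toAlternating-odd-off σ {k} even = toAlternating-off-slot σ λ on →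
  1+n≢n (trans on (trans (cong (slot σ) (⌊1+2n/2⌋≡n k)) even))

toAlternating-up : ∀ σ {k} → k < σ k →
  toAlternating σ (double k) ≡ slot σ (σ k) × toAlternating σ (suc (double k)) ≡ suc (double k)
toAlternating-up σ {k} up =
  trans (cong (toAlternating σ) (sym (slot-up σ up))) (toAlternating-slot σ k) ,
  toAlternating-odd-off σ (slot-up σ up)

toAlternating-down : ∀ σ {k} → σ k < k →
  toAlternating σ (double k) ≡ double k × toAlternating σ (suc (double k)) ≡ slot σ (σ k)
toAlternating-down σ {k} down =
  toAlternating-even-off σ (slot-down σ (<-asym down)) ,
  trans (cong (toAlternating σ) (sym (slot-down σ (<-asym down)))) (toAlternating-slot σ k)

toDerangement-cong : ∀ {f g m} → (∀ {i} → i < double m → f i ≡ g i) →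
  ∀ {k} → k < m → toDerangement f k ≡ toDerangement g k
toDerangement-cong {f} {g} f≗g {k} k<m = cong ⌊_/2⌋ (begin
  f (unfixedIn f k)  ≡⟨ cong f unfixedIn≡ ⟩
  f (unfixedIn g k)  ≡⟨ f≗g (unfixedIn-< g k<m) ⟩
  g (unfixedIn g k)  ∎)
  where
  open ≡-Reasoning
  unfixedIn≡ : unfixedIn f k ≡ unfixedIn g k
  unfixedIn≡ = cong (λ x → if does (x ≟ double k) then suc (double k) else double k) (f≗g (2m<2n k<m))

slot-cong : ∀ σ τ j → σ j ≡ τ j → slot σ j ≡ slot τ j
slot-cong σ τ j σj≡τj = cong (λ x → if does (j <? x) then double j else suc (double j)) σj≡τj

toAlternating-cong : ∀ {σ τ m} → (∀ {k} → k < m → σ k < m) → (∀ {k} → k < m → σ k ≡ τ k) →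
  ∀ {i} → i < double m → toAlternating σ i ≡ toAlternating τ i
toAlternating-cong {σ} {τ} {m} σ-bounded σ≗τ {i} i<2m =
  cong₂ (λ s t → if does (i ≟ s) then t else i) (slot-cong σ τ a (σ≗τ a<m)) (begin
    slot σ (σ a)  ≡⟨ slot-cong σ τ (σ a) (σ≗τ (σ-bounded a<m)) ⟩
    slot τ (σ a)  ≡⟨ cong (slot τ) (σ≗τ a<m) ⟩
    slot τ (τ a)  ∎)
  where
  open ≡-Reasoning
  a : ℕ
  a = ⌊ i /2⌋
  a<m : a < m
  a<m = ⌊n/2⌋<m i<2m

module FromAlternating {f : ℕ → ℕ} {m : ℕ} (H : IsPairFixingAlternating f m) where
  open IsPairFixingAlternating H
  open IsPermutation permutation
  open Alternating alternating

  unfixedIn-not-fixed : ∀ {k} → k < m → f (unfixedIn f k) ≢ unfixedIn f k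
  unfixedIn-not-fixed {k} k<m with f (double k) ≟ double k
  ... | yes fixed rewrite unfixedIn-fixed f fixed = λ odd-fixed →
        descent⇒never-both-fixed alternating k<m (fixed , odd-fixed)
  ... | no unfixed rewrite unfixedIn-unfixed f unfixed = unfixed

  unfixed⇒unfixedIn : ∀ {i} → i < double m → f i ≢ i → unfixedIn f ⌊ i /2⌋ ≡ i
  unfixed⇒unfixedIn {i} i<2m unfixed with parity i
  ... | inj₁ even = trans (unfixedIn-unfixed f (unfixed ∘ subst (λ x → f x ≡ x) (sym even))) (sym even)
  ... | inj₂ odd  = trans (unfixedIn-fixed f even-fixed) (sym odd)
    where
    even-fixed : f (double ⌊ i /2⌋) ≡ double ⌊ i /2⌋
    even-fixed with fixed-in-each-pair (⌊n/2⌋<m i<2m)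
    ... | inj₁ fixed     = fixed
    ... | inj₂ odd-fixed = contradiction (subst (λ x → f x ≡ x) (sym odd) odd-fixed) unfixed

  off-unfixedIn⇒fixed : ∀ {i} → i < double m → i ≢ unfixedIn f ⌊ i /2⌋ → f i ≡ i
  off-unfixedIn⇒fixed {i} i<2m off with f i ≟ i
  ... | yes fixed   = fixed
  ... | no  unfixed = contradiction (sym (unfixed⇒unfixedIn i<2m unfixed)) off

  f∘unfixedIn : ∀ {k} → k < m → f (unfixedIn f k) ≡ unfixedIn f (toDerangement f k)
  f∘unfixedIn {k} k<m = sym (unfixed⇒unfixedIn (bounded u<2m) λ fixed →
    unfixedIn-not-fixed k<m (injective (bounded u<2m) u<2m fixed))
    where
    u<2m : unfixedIn f k < double m
    u<2m = unfixedIn-< f k<m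

  toDerangement-< : ∀ {k} → k < m → toDerangement f k < m
  toDerangement-< k<m = ⌊n/2⌋<m (bounded (unfixedIn-< f k<m))

  toDerangement-isDerangement : IsDerangement (toDerangement f) m
  toDerangement-isDerangement = record
    { permutation      = record { bounded = toDerangement-< ; injective = inj }
    ; fixed-point-free = λ k<m φk≡k → unfixedIn-not-fixed k<m (trans (f∘unfixedIn k<m) (cong (unfixedIn f) φk≡k))
    }
    where
    inj : ∀ {k l} → k < m → l < m → toDerangement f k ≡ toDerangement f l → k ≡ l
    inj {k} {l} k<m l<m φk≡φl = begin
      k                    ≡⟨ sym (⌊unfixedIn/2⌋ f k) ⟩
      ⌊ unfixedIn f k /2⌋  ≡⟨ cong ⌊_/2⌋ (injective (unfixedIn-< f k<m) (unfixedIn-< f l<m) f-unfixedIn≡) ⟩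
      ⌊ unfixedIn f l /2⌋  ≡⟨ ⌊unfixedIn/2⌋ f l ⟩
      l                    ∎
      where
      open ≡-Reasoning
      f-unfixedIn≡ : f (unfixedIn f k) ≡ f (unfixedIn f l)
      f-unfixedIn≡ = trans (f∘unfixedIn k<m) (trans (cong (unfixedIn f) φk≡φl) (sym (f∘unfixedIn l<m)))

  toDerangement-down : ∀ {k} → k < m → f (double k) ≡ double k → toDerangement f k < k
  toDerangement-down {k} k<m fixed rewrite unfixedIn-fixed f fixed =
    ⌊n/2⌋<m (subst (f (suc (double k)) <_) fixed (descent (1+2m<2n k<m)))

  toDerangement-up : ∀ {k} → k < m → f (double k) ≢ double k → k < toDerangement f k
  toDerangement-up {k} k<m unfixed rewrite unfixedIn-unfixed f unfixed =
    subst (_≤ ⌊ f (double k) /2⌋) (cong suc (⌊2n/2⌋≡n k)) (⌊n/2⌋-mono (subst (_< f (double k)) odd-fixed (descent (1+2m<2n k<m))))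
    where
    odd-fixed : f (suc (double k)) ≡ suc (double k)
    odd-fixed with fixed-in-each-pair k<m
    ... | inj₁ fixed     = contradiction fixed unfixed
    ... | inj₂ odd-fixed = odd-fixed

  slot-toDerangement : ∀ {k} → k < m → slot (toDerangement f) k ≡ unfixedIn f k
  slot-toDerangement {k} k<m with f (double k) ≟ double k
  ... | yes fixed  = trans (slot-down (toDerangement f) (<-asym (toDerangement-down k<m fixed))) (sym (unfixedIn-fixed f fixed))
  ... | no unfixed = trans (slot-up (toDerangement f) (toDerangement-up k<m unfixed)) (sym (unfixedIn-unfixed f unfixed))

  toAlternating∘toDerangement : ∀ {i} → i < double m → toAlternating (toDerangement f) i ≡ f i
  toAlternating∘toDerangement {i} i<2m with i ≟ unfixedIn f ⌊ i /2⌋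
  ... | yes on = begin
    toAlternating φ i      ≡⟨ toAlternating-on-slot φ (trans on (sym (slot-toDerangement a<m))) ⟩
    slot φ (φ a)           ≡⟨ slot-toDerangement (toDerangement-< a<m) ⟩
    unfixedIn f (φ a)      ≡⟨ sym (f∘unfixedIn a<m) ⟩
    f (unfixedIn f a)      ≡⟨ cong f (sym on) ⟩
    f i                    ∎
    where
    open ≡-Reasoning
    φ : ℕ → ℕ
    φ = toDerangement f
    a : ℕ
    a = ⌊ i /2⌋
    a<m : a < m
    a<m = ⌊n/2⌋<m i<2m
  ... | no off = trans (toAlternating-off-slot (toDerangement f) (off ∘ λ on → trans on (slot-toDerangement (⌊n/2⌋<m i<2m))))
                       (sym (off-unfixedIn⇒fixed i<2m off))

≡slot⇒on-slot : ∀ σ {c j} → slot σ c ≡ j → j ≡ slot σ ⌊ j /2⌋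
≡slot⇒on-slot σ {c} refl = cong (slot σ) (sym (⌊slot/2⌋ σ c))

module FromDerangement {σ : ℕ → ℕ} {m : ℕ} (H : IsDerangement σ m) where
  open IsDerangement H
  open IsPermutation permutation

  up-or-down : ∀ {k} → k < m → k < σ k ⊎ σ k < k
  up-or-down {k} k<m with k <? σ k
  ... | yes up  = inj₁ up
  ... | no ¬up = inj₂ (≤∧≢⇒< (≮⇒≥ ¬up) (fixed-point-free k<m))

  slot-< : ∀ {j} → j < m → slot σ j < double m
  slot-< {j} j<m = ≤-<-trans (slot-≤ σ j) (1+2m<2n j<m)

  toAlternating-< : ∀ {i} → i < double m → toAlternating σ i < double m
  toAlternating-< {i} i<2m with i ≟ slot σ ⌊ i /2⌋
  ... | yes on  = subst (_< double m) (sym (toAlternating-on-slot σ on)) (slot-< (bounded (⌊n/2⌋<m i<2m)))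
  ... | no  off = subst (_< double m) (sym (toAlternating-off-slot σ off)) i<2m

  toAlternating-injective : ∀ {i j} → i < double m → j < double m → toAlternating σ i ≡ toAlternating σ j → i ≡ j
  toAlternating-injective {i} {j} i<2m j<2m ψi≡ψj with i ≟ slot σ ⌊ i /2⌋ | j ≟ slot σ ⌊ j /2⌋
  ... | yes i-on | yes j-on = begin
    i                   ≡⟨ i-on ⟩
    slot σ ⌊ i /2⌋      ≡⟨ cong (slot σ) (injective (⌊n/2⌋<m i<2m) (⌊n/2⌋<m j<2m) σ-halves≡) ⟩
    slot σ ⌊ j /2⌋      ≡⟨ sym j-on ⟩
    j                   ∎
    where
    open ≡-Reasoning
    slots≡ : slot σ (σ ⌊ i /2⌋) ≡ slot σ (σ ⌊ j /2⌋)
    slots≡ = trans (sym (toAlternating-on-slot σ i-on)) (trans ψi≡ψj (toAlternating-on-slot σ j-on))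
    σ-halves≡ : σ ⌊ i /2⌋ ≡ σ ⌊ j /2⌋
    σ-halves≡ = trans (sym (⌊slot/2⌋ σ _)) (trans (cong ⌊_/2⌋ slots≡) (⌊slot/2⌋ σ _))
  ... | yes i-on | no j-off = contradiction (≡slot⇒on-slot σ
        (trans (sym (toAlternating-on-slot σ i-on)) (trans ψi≡ψj (toAlternating-off-slot σ j-off)))) j-off
  ... | no i-off | yes j-on = contradiction (≡slot⇒on-slot σ
        (trans (sym (toAlternating-on-slot σ j-on)) (trans (sym ψi≡ψj) (toAlternating-off-slot σ i-off)))) i-off
  ... | no i-off | no j-off =
        trans (sym (toAlternating-off-slot σ i-off)) (trans ψi≡ψj (toAlternating-off-slot σ j-off))

  toAlternating-even-≥ : ∀ {k} → k < m → double k ≤ toAlternating σ (double k)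
  toAlternating-even-≥ {k} k<m with up-or-down k<m
  ... | inj₁ up   = subst (double k ≤_) (sym (proj₁ (toAlternating-up σ up)))
                          (≤-trans (<⇒≤ (2m<2n up)) (slot-≥ σ (σ k)))
  ... | inj₂ down = ≤-reflexive (sym (proj₁ (toAlternating-down σ down)))

  toAlternating-odd-≤ : ∀ {k} → k < m → toAlternating σ (suc (double k)) ≤ suc (double k)
  toAlternating-odd-≤ {k} k<m with up-or-down k<m
  ... | inj₁ up   = ≤-reflexive (proj₂ (toAlternating-up σ up))
  ... | inj₂ down = subst (_≤ suc (double k)) (sym (proj₂ (toAlternating-down σ down)))
                          (≤-trans (slot-≤ σ (σ k)) (<⇒≤ (<-trans (1+2m<2n down) (n<1+n _))))

  toAlternating-descent : ∀ {k} → k < m → toAlternating σ (suc (double k)) < toAlternating σ (double k)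
  toAlternating-descent {k} k<m with up-or-down k<m
  ... | inj₁ up   = subst₂ _<_ (sym (proj₂ (toAlternating-up σ up))) (sym (proj₁ (toAlternating-up σ up)))
                           (<-≤-trans (1+2m<2n up) (slot-≥ σ (σ k)))
  ... | inj₂ down = subst₂ _<_ (sym (proj₂ (toAlternating-down σ down))) (sym (proj₁ (toAlternating-down σ down)))
                           (≤-<-trans (slot-≤ σ (σ k)) (1+2m<2n down))

  toAlternating-isPairFixingAlternating : IsPairFixingAlternating (toAlternating σ) m
  toAlternating-isPairFixingAlternating = record
    { permutation = record { bounded = toAlternating-< ; injective = toAlternating-injective }
    ; alternating = record
      { descent = λ lt → toAlternating-descent (1+2m<2n⇒m<n lt)
      ; ascent  = λ {k} lt → ≤-trans (s≤s (toAlternating-odd-≤ (<-trans (n<1+n k) (2m<2n⇒m<n lt))))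
                                    (toAlternating-even-≥ (2m<2n⇒m<n lt))
      }
    ; fixed-in-each-pair = fixed
    }
    where
    fixed : InEachPair (λ i → toAlternating σ i ≡ i) m
    fixed k<m with up-or-down k<m
    ... | inj₁ up   = inj₂ (proj₂ (toAlternating-up σ up))
    ... | inj₂ down = inj₁ (proj₁ (toAlternating-down σ down))

  unfixedIn-toAlternating : ∀ {k} → k < m → unfixedIn (toAlternating σ) k ≡ slot σ k
  unfixedIn-toAlternating {k} k<m with up-or-down k<m
  ... | inj₁ up   = trans (unfixedIn-unfixed (toAlternating σ) (>⇒≢ moved-up)) (sym (slot-up σ up))
    where
    moved-up : double k < toAlternating σ (double k)
    moved-up = subst (double k <_) (sym (proj₁ (toAlternating-up σ up)))
                     (<-≤-trans (2m<2n up) (slot-≥ σ (σ k)))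
  ... | inj₂ down = trans (unfixedIn-fixed (toAlternating σ) (proj₁ (toAlternating-down σ down)))
                          (sym (slot-down σ (<-asym down)))

  toDerangement∘toAlternating : ∀ {k} → k < m → toDerangement (toAlternating σ) k ≡ σ k
  toDerangement∘toAlternating {k} k<m = begin
    ⌊ toAlternating σ (unfixedIn (toAlternating σ) k) /2⌋  ≡⟨ cong (λ i → ⌊ toAlternating σ i /2⌋) (unfixedIn-toAlternating k<m) ⟩
    ⌊ toAlternating σ (slot σ k) /2⌋                        ≡⟨ cong ⌊_/2⌋ (toAlternating-slot σ k) ⟩
    ⌊ slot σ (σ k) /2⌋                                      ≡⟨ ⌊slot/2⌋ σ (σ k) ⟩
    σ k                                                     ∎
    where open ≡-Reasoning

-- Vectors as functions

values : ∀ {N n} → Vec (Fin N) n → List ℕ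
values v = map toℕ (toList v)

⟦_⟧ : ∀ {N n} → Vec (Fin N) n → ℕ → ℕ
⟦ v ⟧ = nth (values v)

length-values : ∀ {N n} (v : Vec (Fin N) n) → length (values v) ≡ n
length-values v = trans (length-map toℕ (toList v)) (length-toList v)

⟦⟧-toℕ : ∀ {N n} (v : Vec (Fin N) n) (j : Fin n) → ⟦ v ⟧ (toℕ j) ≡ toℕ (lookup v j)
⟦⟧-toℕ (x ∷ v) Fin.zero    = refl
⟦⟧-toℕ (x ∷ v) (Fin.suc j) = ⟦⟧-toℕ v j

⟦⟧-fromℕ< : ∀ {N n} (v : Vec (Fin N) n) {i} (i<n : i < n) → ⟦ v ⟧ i ≡ toℕ (lookup v (fromℕ< i<n))
⟦⟧-fromℕ< v i<n = trans (cong ⟦ v ⟧ (sym (toℕ-fromℕ< i<n))) (⟦⟧-toℕ v (fromℕ< i<n))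

⟦⟧-< : ∀ {N n} (v : Vec (Fin N) n) {i} → i < n → ⟦ v ⟧ i < N
⟦⟧-< v i<n = subst (_< _) (sym (⟦⟧-fromℕ< v i<n)) (toℕ<n _)

⟦⟧-injective : ∀ {N n} {v w : Vec (Fin N) n} → (∀ {i} → i < n → ⟦ v ⟧ i ≡ ⟦ w ⟧ i) → v ≡ w
⟦⟧-injective {v = v} {w} v≗w = begin
  v                     ≡⟨ tabulate∘lookup v ⟨
  Vec.tabulate (lookup v) ≡⟨ tabulate-cong (λ j → toℕ-injective (trans (sym (⟦⟧-toℕ v j)) (trans (v≗w (toℕ<n j)) (⟦⟧-toℕ w j)))) ⟩
  Vec.tabulate (lookup w) ≡⟨ tabulate∘lookup w ⟩
  w                     ∎
  where open ≡-Reasoning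

-- Entries f i ≥ n are reduced modulo n; the index j : Fin n witnesses that n is nonzero.
fromFunction : (n : ℕ) → (ℕ → ℕ) → Vec (Fin n) n
fromFunction n f = Vec.tabulate λ j → _mod_ (f (toℕ j)) n {{nonZeroIndex j}}

⟦fromFunction⟧ : ∀ n f {i} → i < n → f i < n → ⟦ fromFunction n f ⟧ i ≡ f i
⟦fromFunction⟧ n f {i} i<n fi<n = begin
  ⟦ fromFunction n f ⟧ i                              ≡⟨ ⟦⟧-fromℕ< (fromFunction n f) i<n ⟩
  toℕ (lookup (fromFunction n f) j)                  ≡⟨ cong toℕ (lookup∘tabulate _ j) ⟩
  toℕ (_mod_ (f (toℕ j)) n {{nonZeroIndex j}})      ≡⟨ toℕ-fromℕ< _ ⟩
  _%_ (f (toℕ j)) n {{nonZeroIndex j}}              ≡⟨ cong (λ x → _%_ (f x) n {{nonZeroIndex j}}) (toℕ-fromℕ< i<n) ⟩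
  _%_ (f i) n {{nonZeroIndex j}}                    ≡⟨ m<n⇒m%n≡m {{nonZeroIndex j}} fi<n ⟩
  f i                                               ∎
  where
  open ≡-Reasoning
  j : Fin n
  j = fromℕ< i<n

allᵇ⁻ : ∀ {A : Set} {p : A → Bool} {xs x} → T (allᵇ p xs) → x ∈ xs → T (p x)
allᵇ⁻ {p = p} {y ∷ _} t (here refl) = proj₁ (Equivalence.to (T-∧ {p y}) t)
allᵇ⁻ {p = p} {y ∷ _} t (there x∈) = allᵇ⁻ (proj₂ (Equivalence.to (T-∧ {p y}) t)) x∈

allᵇ-false : ∀ {A : Set} {p : A → Bool} xs → allᵇ p xs ≡ false → ∃ λ x → x ∈ xs × p x ≡ false
allᵇ-false {p = p} (x ∷ xs) all≡false with p x in px
... | false = x , here refl , px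
... | true  with y , y∈ , py ← allᵇ-false xs all≡false = y , there y∈ , py

isPerm⇒lookup-injective : ∀ {n} (v : Vec (Fin n) n) → T (isPerm v) → ∀ i j → lookup v i ≡ lookup v j → i ≡ j
isPerm⇒lookup-injective {n} v perm i j vi≡vj
  with toℕ i ≡ᵇ toℕ j in i≡ᵇj | toℕ (lookup v i) ≡ᵇ toℕ (lookup v j) in vi≡ᵇvj
     | allᵇ⁻ (allᵇ⁻ perm (∈-allFin i)) (∈-allFin j)
... | true  | _     | _  = toℕ-injective (≡ᵇ⇒≡ _ _ (subst T (sym i≡ᵇj) tt))
... | false | true  | ()
... | false | false | _  = ⊥-elim (subst T vi≡ᵇvj (≡⇒≡ᵇ _ _ (cong toℕ vi≡vj)))

lookup-injective⇒isPerm : ∀ {n} (v : Vec (Fin n) n) → (∀ i j → lookup v i ≡ lookup v j → i ≡ j) → T (isPerm v)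
lookup-injective⇒isPerm {n} v inj with isPerm v in perm
... | true  = tt
... | false
  with i , _ , row   ← allᵇ-false (allFin n) perm
  with j , _ , entry ← allᵇ-false (allFin n) row
  with toℕ i ≡ᵇ toℕ j in i≡ᵇj | toℕ (lookup v i) ≡ᵇ toℕ (lookup v j) in vi≡ᵇvj
... | true  | _     = contradiction entry λ ()
... | false | false = contradiction entry λ ()
... | false | true  = subst T i≡ᵇj (≡⇒≡ᵇ _ _ (cong toℕ (inj i j (toℕ-injective (≡ᵇ⇒≡ _ _ (subst T (sym vi≡ᵇvj) tt))))))

isPerm⇔permutation : ∀ {n} (v : Vec (Fin n) n) → T (isPerm v) ⇔ IsPermutation ⟦ v ⟧ n
isPerm⇔permutation {n} v = mk⇔
  (λ perm → record { bounded = ⟦⟧-< v ; injective = injective (isPerm⇒lookup-injective v perm) })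
  (λ perm → lookup-injective⇒isPerm v λ i j vi≡vj → toℕ-injective (IsPermutation.injective perm (toℕ<n i) (toℕ<n j)
     (trans (⟦⟧-toℕ v i) (trans (cong toℕ vi≡vj) (sym (⟦⟧-toℕ v j))))))
  where
  injective : (∀ i j → lookup v i ≡ lookup v j → i ≡ j) → ∀ {i j} → i < n → j < n → ⟦ v ⟧ i ≡ ⟦ v ⟧ j → i ≡ j
  injective inj {i} {j} i<n j<n vi≡vj = begin
    i                 ≡⟨ toℕ-fromℕ< i<n ⟨
    toℕ (fromℕ< i<n)  ≡⟨ cong toℕ (inj _ _ (toℕ-injective (trans (sym (⟦⟧-fromℕ< v i<n)) (trans vi≡vj (⟦⟧-fromℕ< v j<n))))) ⟩
    toℕ (fromℕ< j<n)  ≡⟨ toℕ-fromℕ< j<n ⟩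
    j                 ∎
    where open ≡-Reasoning

length-filterᵇ-tabulate : ∀ {A : Set} n (g : Fin n → A) (q : A → Bool) {P : Pred ℕ 0ℓ} (P? : Decidable P) →
  (∀ j → q (g j) ≡ does (P? (toℕ j))) → length (filterᵇ q (tabulate g)) ≡ countBelow P? n
length-filterᵇ-tabulate zero    g q P? q≡P? = refl
length-filterᵇ-tabulate (suc n) g q P? q≡P? with q (g Fin.zero) | does (P? 0) | q≡P? Fin.zero
... | true  | true  | refl = cong suc (length-filterᵇ-tabulate n (g ∘ Fin.suc) q (P? ∘ suc) (q≡P? ∘ Fin.suc))
... | false | false | refl = length-filterᵇ-tabulate n (g ∘ Fin.suc) q (P? ∘ suc) (q≡P? ∘ Fin.suc)

fixedPoints≡countBelow : ∀ {n} (v : Vec (Fin n) n) → fixedPoints v ≡ countBelow (λ i → ⟦ v ⟧ i ≟ i) n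
fixedPoints≡countBelow {n} v =
  length-filterᵇ-tabulate n (λ j → j) _ (λ i → ⟦ v ⟧ i ≟ i) λ j → cong (_≡ᵇ toℕ j) (sym (⟦⟧-toℕ v j))

∈-perms⇔ : ∀ {n} {v : Vec (Fin n) n} → v ∈ perms n ⇔ IsPermutation ⟦ v ⟧ n
∈-perms⇔ {n} {v} = mk⇔
  (λ v∈ → Equivalence.to (isPerm⇔permutation v) (proj₂ (∈-filter⁻ (T? ∘ isPerm) {xs = allWords n n} v∈)))
  (λ perm → ∈-filter⁺ (T? ∘ isPerm) (∈-allWords v) (Equivalence.from (isPerm⇔permutation v) perm))

perms-unique : ∀ n → Unique (perms n)
perms-unique n = Unique.filter⁺ (T? ∘ isPerm) (allWords-unique n n)

alternatingPerms : (k n : ℕ) → List (Vec (Fin n) n)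
alternatingPerms k n = filterᵇ (λ w → isAlternating w ∧ (fixedPoints w ≡ᵇ k)) (perms n)

derangements : (m : ℕ) → List (Vec (Fin m) m)
derangements m = filterᵇ (λ w → fixedPoints w ≡ᵇ 0) (perms m)

∈-alternatingPerms⇔ : ∀ {m} {w : Vec (Fin (double m)) (double m)} →
  w ∈ alternatingPerms m (double m) ⇔ IsPairFixingAlternating ⟦ w ⟧ m
∈-alternatingPerms⇔ {m} {w} = mk⇔ to from
  where
  P? : Decidable (λ i → ⟦ w ⟧ i ≡ i)
  P? i = ⟦ w ⟧ i ≟ i
  to : w ∈ alternatingPerms m (double m) → IsPairFixingAlternating ⟦ w ⟧ m
  to w∈ with w∈perms , alt∧fixed ← ∈-filter⁻ (T? ∘ _) w∈
            with alt , fixed ← Equivalence.to T-∧ alt∧fixed = record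
    { permutation        = Equivalence.to ∈-perms⇔ w∈perms
    ; alternating        = alternating
    ; fixed-in-each-pair = countBelow-pairs≡⁻ P? m (descent⇒never-both-fixed alternating)
                             (trans (sym (fixedPoints≡countBelow w)) (≡ᵇ⇒≡ _ _ fixed))
    }
    where
    alternating : Alternating ⟦ w ⟧ (double m)
    alternating = subst (Alternating ⟦ w ⟧) (length-values w) (downUp⇒alternating (values w) alt)
  from : IsPairFixingAlternating ⟦ w ⟧ m → w ∈ alternatingPerms m (double m)
  from H = ∈-filter⁺ (T? ∘ _) (Equivalence.from ∈-perms⇔ permutation) (Equivalence.from T-∧
    ( alternating⇒downUp (values w) (subst (Alternating ⟦ w ⟧) (sym (length-values w)) alternating)
    , ≡⇒≡ᵇ _ _ (trans (fixedPoints≡countBelow w)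
                  (countBelow-pairs≡ P? m (descent⇒never-both-fixed alternating) fixed-in-each-pair))))
    where open IsPairFixingAlternating H

∈-derangements⇔ : ∀ {m} {u : Vec (Fin m) m} → u ∈ derangements m ⇔ IsDerangement ⟦ u ⟧ m
∈-derangements⇔ {m} {u} = mk⇔ to from
  where
  P? : Decidable (λ i → ⟦ u ⟧ i ≡ i)
  P? i = ⟦ u ⟧ i ≟ i
  to : u ∈ derangements m → IsDerangement ⟦ u ⟧ m
  to u∈ with u∈perms , no-fixed ← ∈-filter⁻ (T? ∘ _) u∈ = record
    { permutation      = Equivalence.to ∈-perms⇔ u∈perms
    ; fixed-point-free = countBelow≡0⁻ P? m (trans (sym (fixedPoints≡countBelow u)) (≡ᵇ⇒≡ _ _ no-fixed))
    }
  from : IsDerangement ⟦ u ⟧ m → u ∈ derangements m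
  from H = ∈-filter⁺ (T? ∘ _) (Equivalence.from ∈-perms⇔ permutation)
    (≡⇒≡ᵇ _ _ (trans (fixedPoints≡countBelow u) (countBelow≡0 P? m fixed-point-free)))
    where open IsDerangement H

-- The bijection on vectors

toDerangementᵛ : ∀ {m} → Vec (Fin (double m)) (double m) → Vec (Fin m) m
toDerangementᵛ {m} w = fromFunction m (toDerangement ⟦ w ⟧)

toAlternatingᵛ : ∀ {m} → Vec (Fin m) m → Vec (Fin (double m)) (double m)
toAlternatingᵛ {m} u = fromFunction (double m) (toAlternating ⟦ u ⟧)

module _ {m : ℕ} (w : Vec (Fin (double m)) (double m)) (H : IsPairFixingAlternating ⟦ w ⟧ m) where
  open FromAlternating H

  ⟦toDerangementᵛ⟧ : ∀ {k} → k < m → ⟦ toDerangementᵛ w ⟧ k ≡ toDerangement ⟦ w ⟧ k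
  ⟦toDerangementᵛ⟧ k<m = ⟦fromFunction⟧ m (toDerangement ⟦ w ⟧) k<m (toDerangement-< k<m)

  toDerangementᵛ-isDerangement : IsDerangement ⟦ toDerangementᵛ w ⟧ m
  toDerangementᵛ-isDerangement = IsDerangement-resp (sym ∘ ⟦toDerangementᵛ⟧) toDerangement-isDerangement

  toAlternatingᵛ∘toDerangementᵛ : toAlternatingᵛ (toDerangementᵛ w) ≡ w
  toAlternatingᵛ∘toDerangementᵛ = ⟦⟧-injective λ {i} i<2m → begin
    ⟦ toAlternatingᵛ (toDerangementᵛ w) ⟧ i  ≡⟨ ⟦fromFunction⟧ (double m) _ i<2m (toAlternating-< i<2m) ⟩
    toAlternating ⟦ toDerangementᵛ w ⟧ i     ≡⟨ toAlternating-cong bounded ⟦toDerangementᵛ⟧ i<2m ⟩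
    toAlternating (toDerangement ⟦ w ⟧) i    ≡⟨ toAlternating∘toDerangement i<2m ⟩
    ⟦ w ⟧ i                                  ∎
    where
    open ≡-Reasoning
    open FromDerangement toDerangementᵛ-isDerangement using (toAlternating-<)
    open IsPermutation (IsDerangement.permutation toDerangementᵛ-isDerangement) using (bounded)

module _ {m : ℕ} (u : Vec (Fin m) m) (H : IsDerangement ⟦ u ⟧ m) where
  open FromDerangement H

  ⟦toAlternatingᵛ⟧ : ∀ {i} → i < double m → ⟦ toAlternatingᵛ u ⟧ i ≡ toAlternating ⟦ u ⟧ i
  ⟦toAlternatingᵛ⟧ i<2m = ⟦fromFunction⟧ (double m) (toAlternating ⟦ u ⟧) i<2m (toAlternating-< i<2m)

  toAlternatingᵛ-isPairFixingAlternating : IsPairFixingAlternating ⟦ toAlternatingᵛ u ⟧ m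
  toAlternatingᵛ-isPairFixingAlternating =
    IsPairFixingAlternating-resp (sym ∘ ⟦toAlternatingᵛ⟧) toAlternating-isPairFixingAlternating

  toDerangementᵛ∘toAlternatingᵛ : toDerangementᵛ (toAlternatingᵛ u) ≡ u
  toDerangementᵛ∘toAlternatingᵛ = ⟦⟧-injective λ {k} k<m → begin
    ⟦ toDerangementᵛ (toAlternatingᵛ u) ⟧ k  ≡⟨ ⟦toDerangementᵛ⟧ (toAlternatingᵛ u) toAlternatingᵛ-isPairFixingAlternating k<m ⟩
    toDerangement ⟦ toAlternatingᵛ u ⟧ k     ≡⟨ toDerangement-cong ⟦toAlternatingᵛ⟧ k<m ⟩
    toDerangement (toAlternating ⟦ u ⟧) k    ≡⟨ toDerangement∘toAlternating k<m ⟩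
    ⟦ u ⟧ k                                  ∎
    where open ≡-Reasoning

d[2m]≡D[m] : ∀ m → d m (double m) ≡ D m
d[2m]≡D[m] m = length-≡-by-inverses
  (Unique.filter⁺ (T? ∘ _) (perms-unique (double m))) (Unique.filter⁺ (T? ∘ _) (perms-unique m))
  toDerangementᵛ toAlternatingᵛ
  (λ {w} → from ∈-derangements⇔ ∘ toDerangementᵛ-isDerangement w ∘ to ∈-alternatingPerms⇔)
  (λ {u} → from ∈-alternatingPerms⇔ ∘ toAlternatingᵛ-isPairFixingAlternating u ∘ to ∈-derangements⇔)
  (λ {w} → toAlternatingᵛ∘toDerangementᵛ w ∘ to ∈-alternatingPerms⇔)
  (λ {u} → toDerangementᵛ∘toAlternatingᵛ u ∘ to ∈-derangements⇔)
  where open Equivalence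

theorem2p1 : (m : ℕ) → d m (2 * m) ≡ D m
theorem2p1 m = subst (λ n → d m n ≡ D m) (double≡2* m) (d[2m]≡D[m] m)
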